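{- Let $l \in \{0,1,2,3\}$ and let $\Gamma = (V_\Gamma, E_\Gamma)$ be a planarizing gadget for the class of $(2,l)$-tight graphs, with distinguished vertices $a,b,c,d$. Then there exist subsets $S_1, S_2 \subseteq V_\Gamma$ such that $a,b \in S_1$, $c,d \notin S_1$ and $|E_\Gamma[S_1]| \geq 2|S_1| - 3$; and $c,d \in S_2$, $a,b \notin S_2$ and $|E_\Gamma[S_2]| \geq 2|S_2| - 3$. Moreover, the induced subgraph $\Gamma[S_1]$ contains a path from $a$ to $b$, and the induced subgraph $\Gamma[S_2]$ contains a path from $c$ to $d$.
   Context: Graphs may be multigraphs. For a graph $G=(V,E)$ and $S \subseteq V$, $G[S]$ is the induced subgraph and $E[S]$ denotes the set of edges with both endpoints in $S$. A graph $G=(V,E)$ with $|V|=n$, $|E|=m$ is $(k,l)$-sparse if every $S \subseteq V$ with $|S| \geq 2$ satisfies $|E[S]| \leq k|S|-l$, and $(k,l)$-tight if it is $(k,l)$-sparse and $m = kn-l$. Given a graph $G$ with a drawing in the plane in which edges $ab$ and $cd$ cross, and a graph $\Gamma$ containing distinct vertices $a,b,c,d$, the graph $G' = G - \{ab,cd\} + \Gamma$ is obtained by deleting the edges $ab$ and $cd$ from $G$ and adding a copy of $\Gamma$ whose vertices $a,b,c,d$ are identified with the vertices $a,b,c,d$ of $G$ (all other vertices and edges of $\Gamma$ being new). A graph $\Gamma$ of constant size with distinct vertices $a,b,c,d$ and a planar embedding in which $a,c,b,d$ appear on the outer face in this order is a planarizing gadget for the class of $(2,l)$-tight graphs if for every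 graph $G$ and every drawing of $G$ with crossing edges $ab, cd$, $G$ is $(2,l)$-tight if and only if $G'$ is $(2,l)$-tight. -}

module Defs where

open import Data.Nat using (ℕ; zero; suc; _+_; _*_; _≤_)
open import Data.Bool using (Bool; _∧_)
open import Data.Fin using (Fin; zero; suc; _↑ˡ_; _↑ʳ_)
open import Data.Fin.Subset using (Subset; _∈_; ∣_∣)
open import Data.Vec using (lookup)
open import Data.List using (List; []; _∷_; length; filterᵇ; map; _++_)
open import Data.List.Membership.Propositional using () renaming (_∈_ to _∈ₗ_)
open import Data.List.Relation.Unary.Unique.Propositional using (Unique)
open import Data.Product using (Σ; _×_; _,_; proj₁; proj₂)
open import Data.Sum using (_⊎_)
open import Relation.Binary.PropositionalEquality using (_≡_; _≢_)
open import Function.Bundles using (_⇔_)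

-- A (multi)graph on the vertex set Fin n is given by its list of edges
-- (each edge an ordered pair of endpoints; orientation is irrelevant).

eCount : ∀ {n} → Subset n → List (Fin n × Fin n) → ℕ
eCount S es = length (filterᵇ (λ e → lookup S (proj₁ e) ∧ lookup S (proj₂ e)) es)

-- (k,l)-sparse : every S with |S| ≥ 2 has |E[S]| ≤ k|S| - l   (stated as |E[S]| + l ≤ k|S|)
Sparse : ℕ → ℕ → (n : ℕ) → List (Fin n × Fin n) → Set
Sparse k l n es = (S : Subset n) → 2 ≤ ∣ S ∣ → eCount S es + l ≤ k * ∣ S ∣

Tight : ℕ → ℕ → (n : ℕ) → List (Fin n × Fin n) → Set
Tight k l n es = Sparse k l n es × (length es + l ≡ k * n)

-- A candidate gadget Γ: vertex set Fin (4 + r), where the distinguished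
-- vertices are a = 0, b = 1, c = 2, d = 3 and the r others are internal.
record Gadget : Set where
  constructor gadget
  field
    r     : ℕ
    edges : List (Fin (4 + r) × Fin (4 + r))

module _ {n r : ℕ} (a b c d : Fin n) where
  embedG : Fin n → Fin (n + r)
  embedG x = x ↑ˡ r

  embedΓ : Fin (4 + r) → Fin (n + r)
  embedΓ zero = a ↑ˡ r
  embedΓ (suc zero) = b ↑ˡ r
  embedΓ (suc (suc zero)) = c ↑ˡ r
  embedΓ (suc (suc (suc zero))) = d ↑ˡ r
  embedΓ (suc (suc (suc (suc i)))) = n ↑ʳ i

-- G' = G - {ab, cd} + Γ, where G has edge list (a,b) ∷ (c,d) ∷ es
replace : ∀ {n} (a b c d : Fin n) (es : List (Fin n × Fin n)) (Γ : Gadget) →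
          List (Fin (n + Gadget.r Γ) × Fin (n + Gadget.r Γ))
replace {n} a b c d es Γ =
  map (λ e → embedG {n} {r} a b c d (proj₁ e) , embedG {n} {r} a b c d (proj₂ e)) es
  ++ map (λ e → embedΓ a b c d (proj₁ e) , embedΓ a b c d (proj₂ e)) (Gadget.edges Γ)
  where r = Gadget.r Γ

Distinct4 : ∀ {n} → Fin n → Fin n → Fin n → Fin n → Set
Distinct4 a b c d = a ≢ b × a ≢ c × a ≢ d × b ≢ c × b ≢ d × c ≢ d

IsPlanarizingGadget : ℕ → Gadget → Set
IsPlanarizingGadget l Γ =
  (n : ℕ) (a b c d : Fin n) → Distinct4 a b c d → (es : List (Fin n × Fin n)) →
  Tight 2 l n ((a , b) ∷ (c , d) ∷ es) ⇔ Tight 2 l (n + Gadget.r Γ) (replace a b c d es Γ)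

Adjacent : ∀ {m} → List (Fin m × Fin m) → Fin m → Fin m → Set
Adjacent es u v = ((u , v) ∈ₗ es) ⊎ ((v , u) ∈ₗ es)

data Walk {m : ℕ} (es : List (Fin m × Fin m)) (S : Subset m) : Fin m → Fin m → Set where
  here : ∀ {v} → v ∈ S → Walk es S v v
  step : ∀ {u v w} → u ∈ S → Adjacent es u v → Walk es S v w → Walk es S u w

walkVertices : ∀ {m es S} {u w : Fin m} → Walk es S u w → List (Fin m)
walkVertices (here {v} _) = v ∷ []
walkVertices (step {u} _ _ p) = u ∷ walkVertices p

Path : ∀ {m} → List (Fin m × Fin m) → Subset m → Fin m → Fin m → Set
Path es S u w = Σ (Walk es S u w) (λ p → Unique (walkVertices p))

gA gB gC gD : ∀ {r} → Fin (4 + r)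
gA = zero
gB = suc zero
gC = suc (suc zero)
gD = suc (suc (suc zero))

{-# OPTIONS --safe #-}
-- Both halves are proved alike, for a terminal pair {x, y} = {a, b} or {c, d}.
--
-- Density. Let G be the 4-vertex graph on the terminals with the crossing edges ab, cd, 4 − l
-- further copies of xy and one edge from each of x, y to the opposite pair. It has 8 − l edges
-- but is not (2,l)-tight ({x, y} spans 5 − l > 4 − l edges), so G′ is not tight; having as many
-- edges as G′ for a tight G, it is not sparse. Apart from the crossing edges, G spans on every
-- terminal set other than {x, y} at most as many edges as one of two tight graphs, whose
-- replacements are sparse; so a violating set of G′ meets the terminals exactly in {x, y}, and
-- its trace S on Γ has |E_Γ[S]| ≥ 2|S| − 3.
--
-- Connectivity. Otherwise S splits into X ∋ y and S − X ∋ x with no edge of Γ[S] between them,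
-- and each part meets the terminals in a single vertex v. Such a part spans at most 2|X| − 2
-- edges: in a tight 5-vertex graph in which a new vertex p is joined to v by 4 − l parallel
-- edges, the replaced graph is sparse on X + p. The two bounds add up to less than 2|S| − 3.
module Submission where

open import Defs
open import Algebra.Properties.CommutativeSemigroup using (interchange)
open import Data.Bool as Bool using (Bool; true; false; T; _∧_; if_then_else_)
open import Data.Empty using (⊥; ⊥-elim)
open import Data.Fin as Fin using (Fin; zero; suc; _↑ˡ_; #_)
open import Data.Fin.Properties using (any?; all?)
open import Data.Fin.Subset using (Subset; inside; outside; _∈_; _∉_; _⊆_; _⊃_; _∪_; _─_; ⁅_⁆; ∣_∣)
open import Data.Fin.Subset.Properties
  using ( _∈?_; anySubset?; ∪-comm; p─q⊆p; x∈p⇒∣p-x∣<∣p∣; x∈⁅x⁆; x∈⁅y⁆⇒x≡y; x∈p∪q⁻; x∈p∪q⁺; q⊆p∪q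
        ; x∈p∧x∉q⇒x∈p─q; ⊆-antisym; drop-∷-⊆; drop-there)
open import Data.Fin.Subset.Induction using (⊃-wellFounded)
open import Data.List using (List; []; _∷_; length; filterᵇ; map; replicate; _++_)
open import Data.List.Properties using (filter-++; length-++; length-map)
open import Data.List.Membership.Propositional using () renaming (_∈_ to _∈ₗ_)
open import Data.List.Relation.Unary.All using ([]; _∷_)
open import Data.List.Relation.Unary.All.Properties using (¬Any⇒All¬)
open import Data.List.Relation.Unary.AllPairs using ([]; _∷_)
open import Data.List.Relation.Unary.Any as Any using (here; there)
open import Data.List.Relation.Unary.Unique.Propositional using (Unique)
open import Data.Nat using (ℕ; suc; _+_; _*_; _∸_; _≤_; _<_; z≤n; s≤s; s≤s⁻¹; _≟_; _≤?_; _<?_)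
open import Data.Nat.Properties
  using ( allUpTo?; ≮⇒≥; <⇒≱; <-irrefl; ≤-reflexive; ≤-trans; +-suc; +-comm; +-assoc; *-suc
        ; *-distribˡ-+; +-cancelˡ-≤; +-mono-≤; +-monoˡ-≤; +-monoʳ-≤; +-commutativeSemigroup
        ; module ≤-Reasoning)
open import Data.Nat.Tactic.RingSolver using (solve-∀)
open import Data.Product using (Σ; ∃; ∃₂; _×_; _,_; proj₁; proj₂)
open import Data.Product.Properties using (≡-dec)
open import Data.Sum using (_⊎_; inj₁; inj₂; [_,_]′; swap)
open import Data.Vec using ([]; _∷_; here; there; lookup; splitAt) renaming (_++_ to _++ᵥ_)
open import Data.Vec.Properties
  using (tabulate∘lookup; []=⇒lookup; lookup⇒[]=; lookup-++ˡ; lookup-++ʳ)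
  renaming (≡-dec to ≡-decᵥ)
open import Function using (_∘_; case_of_)
open import Function.Bundles using (Equivalence)
open import Induction.WellFounded using (Acc; acc)
open import Relation.Nullary using (¬_; Dec; yes; no)
open import Relation.Nullary.Decidable
  using (True; toWitness; _×-dec_; _⊎-dec_; _→-dec_; ¬?; map′; decidable-stable)
open import Relation.Unary using (Pred; Decidable)
open import Relation.Binary.PropositionalEquality
  using (_≡_; refl; sym; trans; cong; cong₂; subst; module ≡-Reasoning)

private
  variable
    m : ℕ

indicator : Bool → ℕ
indicator b = if b then 1 else 0

length-filterᵇ-∷ : ∀ {A : Set} (p : A → Bool) x xs →
  length (filterᵇ p (x ∷ xs)) ≡ indicator (p x) + length (filterᵇ p xs)
length-filterᵇ-∷ p x xs with p x
... | true  = refl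
... | false = refl

indicator-≤-+ : ∀ a b c → (T a → T b ⊎ T c) → indicator a ≤ indicator b + indicator c
indicator-≤-+ false _     _     _ = z≤n
indicator-≤-+ true  true  _     _ = s≤s z≤n
indicator-≤-+ true  false true  _ = s≤s z≤n
indicator-≤-+ true  false false h with h _
... | inj₁ ()
... | inj₂ ()

length-filterᵇ-≤-+ : ∀ {A : Set} (p q r : A → Bool) xs →
  (∀ {x} → x ∈ₗ xs → T (p x) → T (q x) ⊎ T (r x)) →
  length (filterᵇ p xs) ≤ length (filterᵇ q xs) + length (filterᵇ r xs)
length-filterᵇ-≤-+ p q r []       _     = z≤n
length-filterᵇ-≤-+ p q r (x ∷ xs) split = begin
  length (filterᵇ p (x ∷ xs))
    ≡⟨ length-filterᵇ-∷ p x xs ⟩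
  indicator (p x) + length (filterᵇ p xs)
    ≤⟨ +-mono-≤ (indicator-≤-+ (p x) (q x) (r x) (split (here refl)))
                (length-filterᵇ-≤-+ p q r xs (split ∘ there)) ⟩
  (indicator (q x) + indicator (r x)) + (length (filterᵇ q xs) + length (filterᵇ r xs))
    ≡⟨ interchange +-commutativeSemigroup (indicator (q x)) (indicator (r x)) _ _ ⟩
  (indicator (q x) + length (filterᵇ q xs)) + (indicator (r x) + length (filterᵇ r xs))
    ≡⟨ cong₂ _+_ (length-filterᵇ-∷ q x xs) (length-filterᵇ-∷ r x xs) ⟨
  length (filterᵇ q (x ∷ xs)) + length (filterᵇ r (x ∷ xs)) ∎
  where open ≤-Reasoning

mapEdges : ∀ {k} → (Fin m → Fin k) → List (Fin m × Fin m) → List (Fin k × Fin k)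
mapEdges φ = map (λ e → φ (proj₁ e) , φ (proj₂ e))

eCount-++ : ∀ (S : Subset m) xs ys → eCount S (xs ++ ys) ≡ eCount S xs + eCount S ys
eCount-++ S xs ys = trans (cong length (filter-++ _ xs ys)) (length-++ (filterᵇ _ xs))

eCount-pullback : ∀ {k} (φ : Fin m → Fin k) (S : Subset k) (S′ : Subset m) →
  (∀ x → lookup S (φ x) ≡ lookup S′ x) → ∀ es → eCount S (mapEdges φ es) ≡ eCount S′ es
eCount-pullback φ S S′ pull [] = refl
eCount-pullback φ S S′ pull ((u , v) ∷ es) rewrite pull u | pull v
  with lookup S′ u ∧ lookup S′ v
... | true  = cong suc (eCount-pullback φ S S′ pull es)
... | false = eCount-pullback φ S S′ pull es

both-∈⁺ : ∀ {S : Subset m} {u v} → u ∈ S → v ∈ S → T (lookup S u ∧ lookup S v)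
both-∈⁺ u∈S v∈S rewrite []=⇒lookup u∈S | []=⇒lookup v∈S = _

both-∈⁻ : ∀ {S : Subset m} {u v} → T (lookup S u ∧ lookup S v) → u ∈ S × v ∈ S
both-∈⁻ {S = S} {u} {v} _ with lookup S u in u∈S | lookup S v in v∈S
... | true | true = lookup⇒[]= u S u∈S , lookup⇒[]= v S v∈S

p⊆q⇒∣p∣+∣q─p∣≡∣q∣ : ∀ {p q : Subset m} → p ⊆ q → ∣ p ∣ + ∣ q ─ p ∣ ≡ ∣ q ∣
p⊆q⇒∣p∣+∣q─p∣≡∣q∣ {p = []}          {[]}          _   = refl
p⊆q⇒∣p∣+∣q─p∣≡∣q∣ {p = outside ∷ p} {outside ∷ q} p⊆q = p⊆q⇒∣p∣+∣q─p∣≡∣q∣ (drop-∷-⊆ p⊆q)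
p⊆q⇒∣p∣+∣q─p∣≡∣q∣ {p = outside ∷ p} {inside  ∷ q} p⊆q =
  trans (+-suc ∣ p ∣ _) (cong suc (p⊆q⇒∣p∣+∣q─p∣≡∣q∣ (drop-∷-⊆ p⊆q)))
p⊆q⇒∣p∣+∣q─p∣≡∣q∣ {p = inside  ∷ p} {inside  ∷ q} p⊆q = cong suc (p⊆q⇒∣p∣+∣q─p∣≡∣q∣ (drop-∷-⊆ p⊆q))
p⊆q⇒∣p∣+∣q─p∣≡∣q∣ {p = inside  ∷ p} {outside ∷ q} p⊆q with p⊆q here
... | ()

x∈p─q⇒x∉q : ∀ {x : Fin m} (p q : Subset m) → x ∈ p ─ q → x ∉ q
x∈p─q⇒x∉q (_ ∷ p) (outside ∷ q) here          = λ ()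
x∈p─q⇒x∉q (_ ∷ p) (_       ∷ q) (there x∈p─q) = x∈p─q⇒x∉q p q x∈p─q ∘ drop-there

↑ˡ-∈⁺ : ∀ {n} {x : Fin m} {p : Subset m} {q : Subset n} → x ∈ p → x ↑ˡ n ∈ p ++ᵥ q
↑ˡ-∈⁺ {x = x} {p} {q} x∈p = lookup⇒[]= _ (p ++ᵥ q) (trans (lookup-++ˡ p q x) ([]=⇒lookup x∈p))

↑ˡ-∈⁻ : ∀ {n} {x : Fin m} {p : Subset m} {q : Subset n} → x ↑ˡ n ∈ p ++ᵥ q → x ∈ p
↑ˡ-∈⁻ {x = x} {p} {q} x∈p++q = lookup⇒[]= x p (trans (sym (lookup-++ˡ p q x)) ([]=⇒lookup x∈p++q))

++-⊆ˡ : ∀ {n} {p q : Subset m} {p′ q′ : Subset n} → p ++ᵥ p′ ⊆ q ++ᵥ q′ → p ⊆ q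
++-⊆ˡ p++p′⊆q++q′ = ↑ˡ-∈⁻ ∘ p++p′⊆q++q′ ∘ ↑ˡ-∈⁺

⊆⁅x⁆∪⁅y⁆⇒≡⁅y⁆ : ∀ {x y : Fin m} {t} → t ⊆ ⁅ x ⁆ ∪ ⁅ y ⁆ → y ∈ t → x ∉ t → t ≡ ⁅ y ⁆
⊆⁅x⁆∪⁅y⁆⇒≡⁅y⁆ {x = x} {y} {t} t⊆ y∈t x∉t = ⊆-antisym t⊆⁅y⁆ ⁅y⁆⊆t
  where
  t⊆⁅y⁆ : t ⊆ ⁅ y ⁆
  t⊆⁅y⁆ z∈t with x∈p∪q⁻ ⁅ x ⁆ ⁅ y ⁆ (t⊆ z∈t)
  ... | inj₁ z∈⁅x⁆ rewrite x∈⁅y⁆⇒x≡y x z∈⁅x⁆ = ⊥-elim (x∉t z∈t)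
  ... | inj₂ z∈⁅y⁆ = z∈⁅y⁆
  ⁅y⁆⊆t : ⁅ y ⁆ ⊆ t
  ⁅y⁆⊆t z∈⁅y⁆ rewrite x∈⁅y⁆⇒x≡y y z∈⁅y⁆ = y∈t

⊆⁅x⁆∪⁅y⁆++⇒≡⁅y⁆++ : ∀ {n} {x y : Fin m} {K : Subset n} {Z} → Z ⊆ (⁅ x ⁆ ∪ ⁅ y ⁆) ++ᵥ K →
  y ↑ˡ n ∈ Z → x ↑ˡ n ∉ Z → ∃ λ KZ → Z ≡ ⁅ y ⁆ ++ᵥ KZ
⊆⁅x⁆∪⁅y⁆++⇒≡⁅y⁆++ {m} {Z = Z} Z⊆ y∈Z x∉Z with splitAt m Z
... | t , KZ , refl = KZ , cong (_++ᵥ KZ) (⊆⁅x⁆∪⁅y⁆⇒≡⁅y⁆ (++-⊆ˡ Z⊆) (↑ˡ-∈⁻ y∈Z) (x∉Z ∘ ↑ˡ-∈⁺))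

allSubset? : ∀ {p} {P : Pred (Subset m) p} → Decidable P → Dec (∀ S → P S)
allSubset? P? = map′ (λ none S → decidable-stable (P? S) (λ ¬PS → none (S , ¬PS)))
                     (λ all (S , ¬PS) → ¬PS (all S))
                     (¬? (anySubset? (¬? ∘ P?)))

walk-start : ∀ {es} {S : Subset m} {u w} → Walk es S u w → u ∈ S
walk-start (here u∈S)     = u∈S
walk-start (step u∈S _ _) = u∈S

path-suffix : ∀ {es} {S : Subset m} {u v w} (p : Walk es S v w) → Unique (walkVertices p) →
  u ∈ₗ walkVertices p → Path es S u w
path-suffix p@(here _)     uniq       (here refl) = p , uniq
path-suffix (here _)       _          (there ())
path-suffix p@(step _ _ _) uniq       (here refl) = p , uniq
path-suffix (step _ _ p)   (_ ∷ uniq) (there u∈p) = path-suffix p uniq u∈p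

walk⇒path : ∀ {es} {S : Subset m} {u w} → Walk es S u w → Path es S u w
walk⇒path (here w∈S) = here w∈S , [] ∷ []
walk⇒path {u = u} (step u∈S adj p) with walk⇒path p
... | q , uniq with Any.any? (u Fin.≟_) (walkVertices q)
...   | yes u∈q = path-suffix q uniq u∈q
...   | no  u∉q = step u∈S adj q , ¬Any⇒All¬ _ u∉q ∷ uniq

adjacent? : ∀ (E : List (Fin m × Fin m)) u v → Dec (Adjacent E u v)
adjacent? E u v =
  Any.any? (≡-dec Fin._≟_ Fin._≟_ (u , v)) E ⊎-dec Any.any? (≡-dec Fin._≟_ Fin._≟_ (v , u)) E

module _ (E : List (Fin m × Fin m)) (Y : Subset m) where

  Closed : Subset m → Set
  Closed X = ∀ {u v} → u ∈ X → v ∈ Y → Adjacent E u v → v ∈ X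

  eCount-split : ∀ {X} → Closed X → eCount Y E ≤ eCount X E + eCount (Y ─ X) E
  eCount-split {X} closed = length-filterᵇ-≤-+ _ _ _ E edge-split
    where
    edge-split : ∀ {e} → e ∈ₗ E → T (lookup Y (proj₁ e) ∧ lookup Y (proj₂ e)) →
      T (lookup X (proj₁ e) ∧ lookup X (proj₂ e)) ⊎
      T (lookup (Y ─ X) (proj₁ e) ∧ lookup (Y ─ X) (proj₂ e))
    edge-split {u , v} uv∈E uv∈Y with both-∈⁻ uv∈Y | u ∈? X
    ... | u∈Y , v∈Y | yes u∈X = inj₁ (both-∈⁺ u∈X (closed u∈X v∈Y (inj₁ uv∈E)))
    ... | u∈Y , v∈Y | no  u∉X = inj₂ (both-∈⁺ (x∈p∧x∉q⇒x∈p─q u∈Y u∉X) (x∈p∧x∉q⇒x∈p─q v∈Y v∉X))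
      where
      v∉X : v ∉ X
      v∉X v∈X = u∉X (closed v∈X u∈Y (inj₂ uv∈E))

  Frontier : Subset m → Fin m → Set
  Frontier X w = w ∈ Y × w ∉ X × ∃ λ u → u ∈ X × Adjacent E u w

  frontier? : ∀ X w → Dec (Frontier X w)
  frontier? X w = w ∈? Y ×-dec ¬? (w ∈? X) ×-dec any? (λ u → u ∈? X ×-dec adjacent? E u w)

  Cut : Fin m → Fin m → Set
  Cut x y = ∃ λ X → X ⊆ Y × y ∈ X × x ∉ X × Closed X

  walk-or-cut-from : ∀ {x y} X → Acc _⊃_ X → y ∈ X → (∀ {v} → v ∈ X → Walk E Y v y) →
    Walk E Y x y ⊎ Cut x y
  walk-or-cut-from {x} X (acc larger) y∈X reach with x ∈? X | any? (frontier? X)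
  ... | yes x∈X | _       = inj₁ (reach x∈X)
  ... | no  x∉X | no none = inj₂ (X , walk-start ∘ reach , y∈X , x∉X , closed)
    where
    closed : Closed X
    closed {u} {v} u∈X v∈Y adj =
      decidable-stable (v ∈? X) (λ v∉X → none (v , v∈Y , v∉X , u , u∈X , adj))
  ... | no  _   | yes (w , w∈Y , w∉X , u , u∈X , adj) =
    walk-or-cut-from (⁅ w ⁆ ∪ X) (larger (q⊆p∪q ⁅ w ⁆ X , w , x∈p∪q⁺ (inj₁ (x∈⁅x⁆ w)) , w∉X))
      (q⊆p∪q ⁅ w ⁆ X y∈X) reach′
    where
    reach′ : ∀ {v} → v ∈ ⁅ w ⁆ ∪ X → Walk E Y v _
    reach′ v∈ with x∈p∪q⁻ ⁅ w ⁆ X v∈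
    ... | inj₁ v∈⁅w⁆ rewrite x∈⁅y⁆⇒x≡y w v∈⁅w⁆ = step w∈Y (swap adj) (reach u∈X)
    ... | inj₂ v∈X = reach v∈X

  walk-or-cut : ∀ {x y} → y ∈ Y → Walk E Y x y ⊎ Cut x y
  walk-or-cut {y = y} y∈Y = walk-or-cut-from ⁅ y ⁆ (⊃-wellFounded _) (x∈⁅x⁆ y) reach
    where
    reach : ∀ {v} → v ∈ ⁅ y ⁆ → Walk E Y v y
    reach v∈⁅y⁆ rewrite x∈⁅y⁆⇒x≡y y v∈⁅y⁆ = here y∈Y

Dense Loose : List (Fin m × Fin m) → Subset m → Set
Dense E S = 2 * ∣ S ∣ ≤ eCount S E + 3
Loose E S = eCount S E + 2 ≤ 2 * ∣ S ∣

closed-split⇒¬dense : ∀ {E} {X Y : Subset m} → X ⊆ Y → Closed E Y X →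
  Loose E X → Loose E (Y ─ X) → ¬ Dense E Y
closed-split⇒¬dense {E = E} {X} {Y} X⊆Y closed looseX looseY─X dense = <-irrefl refl (begin-strict
  2 * ∣ Y ∣                                  ≤⟨ dense ⟩
  eCount Y E + 3                             ≤⟨ +-monoˡ-≤ 3 (eCount-split E Y closed) ⟩
  eCount X E + eCount (Y ─ X) E + 3          <⟨ ≤-reflexive (shuffle (eCount X E) _) ⟩
  (eCount X E + 2) + (eCount (Y ─ X) E + 2)  ≤⟨ +-mono-≤ looseX looseY─X ⟩
  2 * ∣ X ∣ + 2 * ∣ Y ─ X ∣                  ≡⟨ *-distribˡ-+ 2 ∣ X ∣ _ ⟨
  2 * (∣ X ∣ + ∣ Y ─ X ∣)                    ≡⟨ cong (2 *_) (p⊆q⇒∣p∣+∣q─p∣≡∣q∣ X⊆Y) ⟩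
  2 * ∣ Y ∣                                  ∎)
  where
  open ≤-Reasoning
  shuffle : ∀ a b → suc (a + b + 3) ≡ a + 2 + (b + 2)
  shuffle = solve-∀

dense⇒path : ∀ {E} {Y : Subset m} {x y} → Dense E Y → y ∈ Y →
  (∀ {X} → X ⊆ Y → y ∈ X → x ∉ X → Loose E X × Loose E (Y ─ X)) → Path E Y x y
dense⇒path {E = E} {Y} dense y∈Y separated with walk-or-cut E Y y∈Y
... | inj₁ walk = walk⇒path walk
... | inj₂ (X , X⊆Y , y∈X , x∉X , closed) =
  let looseX , looseY─X = separated X⊆Y y∈X x∉X in
  ⊥-elim (closed-split⇒¬dense X⊆Y closed looseX looseY─X dense)

sparse? : ∀ k l n es → Dec (Sparse k l n es)
sparse? k l n es = allSubset? (λ S → 2 ≤? ∣ S ∣ →-dec eCount S es + l ≤? k * ∣ S ∣)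

tight? : ∀ k l n es → Dec (Tight k l n es)
tight? k l n es = sparse? k l n es ×-dec length es + l ≟ k * n

Violation : ℕ → ℕ → List (Fin m × Fin m) → Subset m → Set
Violation k l es S = 2 ≤ ∣ S ∣ × k * ∣ S ∣ < eCount S es + l

¬sparse⇒violation : ∀ k l n es → ¬ Sparse k l n es → ∃ (Violation k l es)
¬sparse⇒violation k l n es ¬sparse = decidable-stable (anySubset? violation?)
  (λ none → ¬sparse (λ S 2≤∣S∣ → ≮⇒≥ (λ violated → none (S , 2≤∣S∣ , violated))))
  where
  violation? : Decidable (Violation k l es)
  violation? S = 2 ≤? ∣ S ∣ ×-dec k * ∣ S ∣ <? eCount S es + l

terminals : ∀ {n} (a b c d : Fin n) → Subset n → Subset 4
terminals a b c d T = lookup T a ∷ lookup T b ∷ lookup T c ∷ lookup T d ∷ []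

replace-eCount : ∀ {n} (a b c d : Fin n) es (Γ : Gadget) (T : Subset n) (J : Subset (Gadget.r Γ)) →
  eCount (T ++ᵥ J) (replace a b c d es Γ) ≡
  eCount T es + eCount (terminals a b c d T ++ᵥ J) (Gadget.edges Γ)
replace-eCount {n} a b c d es Γ T J =
  trans (eCount-++ (T ++ᵥ J) (mapEdges embedG′ es) (mapEdges embedΓ′ (Gadget.edges Γ)))
        (cong₂ _+_ (eCount-pullback embedG′ (T ++ᵥ J) T (lookup-++ˡ T J) es)
                   (eCount-pullback embedΓ′ (T ++ᵥ J) (terminals a b c d T ++ᵥ J) lookup-embedΓ
                                    (Gadget.edges Γ)))
  where
  embedG′ embedΓ′ : Fin _ → Fin (n + Gadget.r Γ)
  embedG′ = embedG {n} {Gadget.r Γ} a b c d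
  embedΓ′ = embedΓ a b c d
  lookup-embedΓ : ∀ x → lookup (T ++ᵥ J) (embedΓ′ x) ≡ lookup (terminals a b c d T ++ᵥ J) x
  lookup-embedΓ zero                      = lookup-++ˡ T J a
  lookup-embedΓ (suc zero)                = lookup-++ˡ T J b
  lookup-embedΓ (suc (suc zero))          = lookup-++ˡ T J c
  lookup-embedΓ (suc (suc (suc zero)))    = lookup-++ˡ T J d
  lookup-embedΓ (suc (suc (suc (suc i)))) = lookup-++ʳ T J i

replace-length : ∀ {n} (a b c d : Fin n) es (Γ : Gadget) →
  length (replace a b c d es Γ) ≡ length es + length (Gadget.edges Γ)
replace-length a b c d es Γ =
  trans (length-++ (mapEdges (embedG {_} {Gadget.r Γ} a b c d) es))
        (cong₂ _+_ (length-map _ es) (length-map _ (Gadget.edges Γ)))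

crossing₄ : List (Fin 4 × Fin 4) → List (Fin 4 × Fin 4)
crossing₄ es = (# 0 , # 1) ∷ (# 2 , # 3) ∷ es

-- Vertex 0 is the extra vertex p; the terminals a, b, c, d are 1, 2, 3, 4.
crossing₅ : List (Fin 5 × Fin 5) → List (Fin 5 × Fin 5)
crossing₅ es = (# 1 , # 2) ∷ (# 3 , # 4) ∷ es

distinct₄ : Distinct4 {4} (# 0) (# 1) (# 2) (# 3)
distinct₄ = (λ ()) , (λ ()) , (λ ()) , (λ ()) , (λ ()) , (λ ())

distinct₅ : Distinct4 {5} (# 1) (# 2) (# 3) (# 4)
distinct₅ = (λ ()) , (λ ()) , (λ ()) , (λ ()) , (λ ()) , (λ ())

record PendantGraph (l : ℕ) (v : Fin 4) : Set where
  field
    edges : List (Fin 5 × Fin 5)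
    tight : Tight 2 l 5 (crossing₅ edges)
    heavy : 4 ≤ eCount (inside ∷ ⁅ v ⁆) edges + l

-- crossing₄ edges is the graph G of the density argument, dominated off T₀ by the tight graphs
-- crossing₄ cover₁ and crossing₄ cover₂.
record Overload (l : ℕ) (T₀ : Subset 4) : Set where
  field
    edges cover₁ cover₂ : List (Fin 4 × Fin 4)
    not-tight    : ¬ Tight 2 l 4 (crossing₄ edges)
    cover₁-tight : Tight 2 l 4 (crossing₄ cover₁)
    cover₂-tight : Tight 2 l 4 (crossing₄ cover₂)
    same-length  : length edges ≡ length cover₁
    covered      : ∀ t → t ≡ T₀ ⊎ eCount t edges ≤ eCount t cover₁ ⊎ eCount t edges ≤ eCount t cover₂
    light-at-T₀  : eCount T₀ edges + l ≤ 4

module Planarizing {l : ℕ} {Γ : Gadget} (planar : IsPlanarizingGadget l Γ) where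
  open Gadget Γ using (r) renaming (edges to E)

  replace-sparse : ∀ {n} {a b c d : Fin n} {es} → Distinct4 a b c d →
    Tight 2 l n ((a , b) ∷ (c , d) ∷ es) → ∀ T J → 2 ≤ ∣ T ++ᵥ J ∣ →
    eCount T es + eCount (terminals a b c d T ++ᵥ J) E + l ≤ 2 * ∣ T ++ᵥ J ∣
  replace-sparse {n} {a} {b} {c} {d} {es} distinct tight T J 2≤∣T++J∣ =
    subst (λ k → k + l ≤ 2 * ∣ T ++ᵥ J ∣) (replace-eCount a b c d es Γ T J)
          (proj₁ (Equivalence.to (planar n a b c d distinct es) tight) (T ++ᵥ J) 2≤∣T++J∣)

  replace-size : ∀ {n} {a b c d : Fin n} {es es₀} → Distinct4 a b c d →
    Tight 2 l n ((a , b) ∷ (c , d) ∷ es₀) → length es ≡ length es₀ →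
    length (replace a b c d es Γ) + l ≡ 2 * (n + r)
  replace-size {n} {a} {b} {c} {d} {es} {es₀} distinct tight₀ same = begin
    length (replace a b c d es Γ) + l   ≡⟨ cong (_+ l) (replace-length a b c d es Γ) ⟩
    length es + length E + l            ≡⟨ cong (λ k → k + length E + l) same ⟩
    length es₀ + length E + l           ≡⟨ cong (_+ l) (replace-length a b c d es₀ Γ) ⟨
    length (replace a b c d es₀ Γ) + l
      ≡⟨ proj₂ (Equivalence.to (planar n a b c d distinct es₀) tight₀) ⟩
    2 * (n + r)                         ∎
    where open ≡-Reasoning

  replace-violation : ∀ {n} {a b c d : Fin n} {es es₀} → Distinct4 a b c d →
    Tight 2 l n ((a , b) ∷ (c , d) ∷ es₀) → length es ≡ length es₀ →
    ¬ Tight 2 l n ((a , b) ∷ (c , d) ∷ es) →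
    ∃₂ λ T J → 2 ≤ ∣ T ++ᵥ J ∣ ×
               2 * ∣ T ++ᵥ J ∣ < eCount T es + eCount (terminals a b c d T ++ᵥ J) E + l
  replace-violation {n} {a} {b} {c} {d} {es} distinct tight₀ same ¬tight
    with ¬sparse⇒violation 2 l (n + r) (replace a b c d es Γ) (λ sparse → ¬tight
           (Equivalence.from (planar n a b c d distinct es)
                             (sparse , replace-size {es = es} distinct tight₀ same)))
  ... | S , 2≤∣S∣ , violated with splitAt n S
  ...   | T , J , refl =
    T , J , 2≤∣S∣ , subst (λ k → 2 * ∣ T ++ᵥ J ∣ < k + l) (replace-eCount a b c d es Γ T J) violated

  crossing₄-sparse : ∀ {es} → Tight 2 l 4 (crossing₄ es) →
    ∀ t K → 2 ≤ ∣ t ++ᵥ K ∣ → eCount t es + eCount (t ++ᵥ K) E + l ≤ 2 * ∣ t ++ᵥ K ∣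
  crossing₄-sparse tight t@(_ ∷ _ ∷ _ ∷ _ ∷ []) = replace-sparse distinct₄ tight t

  crossing₄-violation : ∀ {es es₀} → Tight 2 l 4 (crossing₄ es₀) → length es ≡ length es₀ →
    ¬ Tight 2 l 4 (crossing₄ es) →
    ∃₂ λ t K → 2 ≤ ∣ t ++ᵥ K ∣ × 2 * ∣ t ++ᵥ K ∣ < eCount t es + eCount (t ++ᵥ K) E + l
  crossing₄-violation {es} tight₀ same ¬tight =
    case replace-violation distinct₄ tight₀ same ¬tight of λ where
      (t , K , 2≤∣Y∣ , violated) →
        t , K , 2≤∣Y∣ ,
        subst (λ t′ → 2 * ∣ t ++ᵥ K ∣ < eCount t es + eCount (t′ ++ᵥ K) E + l)
              (tabulate∘lookup t) violated

  crossing₅-sparse : ∀ {es} → Tight 2 l 5 (crossing₅ es) → ∀ t K → 1 ≤ ∣ t ++ᵥ K ∣ →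
    eCount (inside ∷ t) es + eCount (t ++ᵥ K) E + l ≤ 2 * suc ∣ t ++ᵥ K ∣
  crossing₅-sparse tight t@(_ ∷ _ ∷ _ ∷ _ ∷ []) K 1≤∣t++K∣ =
    replace-sparse distinct₅ tight (inside ∷ t) K (s≤s 1≤∣t++K∣)

  pendant-loose : ∀ {v} → PendantGraph l v → ∀ K → Loose E (⁅ v ⁆ ++ᵥ K)
  pendant-loose {v} pendant K = +-cancelˡ-≤ 2 _ _ (begin
    2 + (e + 2)              ≡⟨ +-comm 2 (e + 2) ⟩
    e + 2 + 2                ≡⟨ +-assoc e 2 2 ⟩
    e + 4                    ≤⟨ +-monoʳ-≤ e heavy ⟩
    e + (c + l)              ≡⟨ shuffle e c l ⟩
    c + e + l                ≤⟨ crossing₅-sparse tight ⁅ v ⁆ K 1≤∣X∣ ⟩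
    2 * suc ∣ ⁅ v ⁆ ++ᵥ K ∣  ≡⟨ *-suc 2 _ ⟩
    2 + 2 * ∣ ⁅ v ⁆ ++ᵥ K ∣  ∎)
    where
    open PendantGraph pendant
    open ≤-Reasoning
    e c : ℕ
    e = eCount (⁅ v ⁆ ++ᵥ K) E
    c = eCount (inside ∷ ⁅ v ⁆) edges
    shuffle : ∀ e c l → e + (c + l) ≡ c + e + l
    shuffle = solve-∀
    1≤∣X∣ : 1 ≤ ∣ ⁅ v ⁆ ++ᵥ K ∣
    1≤∣X∣ = ≤-trans (s≤s z≤n) (x∈p⇒∣p-x∣<∣p∣ (↑ˡ-∈⁺ {q = K} (x∈⁅x⁆ v)))

  overload-dense : ∀ {T₀} → Overload l T₀ → ∃ λ K → Dense E (T₀ ++ᵥ K)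
  overload-dense {T₀} o =
    let t , K , 2≤∣Y∣ , violated = crossing₄-violation cover₁-tight same-length not-tight in
    K , dense-at t K 2≤∣Y∣ violated (covered t)
    where
    open Overload o
    open ≤-Reasoning
    dense-at : ∀ t K → 2 ≤ ∣ t ++ᵥ K ∣ → 2 * ∣ t ++ᵥ K ∣ < eCount t edges + eCount (t ++ᵥ K) E + l →
      t ≡ T₀ ⊎ eCount t edges ≤ eCount t cover₁ ⊎ eCount t edges ≤ eCount t cover₂ →
      Dense E (T₀ ++ᵥ K)
    dense-at t K _ violated (inj₁ refl) = s≤s⁻¹ (begin
      suc (2 * ∣ t ++ᵥ K ∣)  ≤⟨ violated ⟩
      c + e + l              ≡⟨ shuffle c e l ⟩
      c + l + e              ≤⟨ +-monoˡ-≤ e light-at-T₀ ⟩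
      4 + e                  ≡⟨ +-comm 4 e ⟩
      e + 4                  ≡⟨ +-suc e 3 ⟩
      suc (e + 3)            ∎)
      where
      c e : ℕ
      c = eCount t edges
      e = eCount (t ++ᵥ K) E
      shuffle : ∀ c e l → c + e + l ≡ c + l + e
      shuffle = solve-∀
    dense-at t K 2≤∣Y∣ violated (inj₂ covered) =
      ⊥-elim ([ refute cover₁-tight , refute cover₂-tight ]′ covered)
      where
      refute : ∀ {cover} → Tight 2 l 4 (crossing₄ cover) → eCount t edges ≤ eCount t cover → ⊥
      refute tight ≤cover = <⇒≱ violated
        (≤-trans (+-monoˡ-≤ l (+-monoˡ-≤ _ ≤cover)) (crossing₄-sparse tight t K 2≤∣Y∣))

  one-terminal-loose : ∀ {x y : Fin 4} {K Z} → PendantGraph l y → Z ⊆ (⁅ x ⁆ ∪ ⁅ y ⁆) ++ᵥ K →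
    y ↑ˡ r ∈ Z → x ↑ˡ r ∉ Z → Loose E Z
  one-terminal-loose pendant Z⊆ y∈Z x∉Z with ⊆⁅x⁆∪⁅y⁆++⇒≡⁅y⁆++ Z⊆ y∈Z x∉Z
  ... | KZ , refl = pendant-loose pendant KZ

  separations-loose : ∀ {x y : Fin 4} {K} → PendantGraph l x → PendantGraph l y →
    ∀ {X} → X ⊆ (⁅ x ⁆ ∪ ⁅ y ⁆) ++ᵥ K → y ↑ˡ r ∈ X → x ↑ˡ r ∉ X →
    Loose E X × Loose E (((⁅ x ⁆ ∪ ⁅ y ⁆) ++ᵥ K) ─ X)
  separations-loose {x} {y} {K} pendant-x pendant-y {X} X⊆Y y∈X x∉X =
    one-terminal-loose pendant-y X⊆Y y∈X x∉X ,
    one-terminal-loose pendant-x (subst (λ T → Y ─ X ⊆ T ++ᵥ K) (∪-comm ⁅ x ⁆ ⁅ y ⁆) (p─q⊆p Y X))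
      (x∈p∧x∉q⇒x∈p─q (↑ˡ-∈⁺ {q = K} (x∈p∪q⁺ (inj₁ (x∈⁅x⁆ x)))) x∉X)
      (λ y∈Y─X → x∈p─q⇒x∉q Y X y∈Y─X y∈X)
    where
    Y : Subset (4 + r)
    Y = (⁅ x ⁆ ∪ ⁅ y ⁆) ++ᵥ K

  pair-with-path : ∀ {x y : Fin 4} → Overload l (⁅ x ⁆ ∪ ⁅ y ⁆) → PendantGraph l x → PendantGraph l y →
    ∃ λ K → Dense E ((⁅ x ⁆ ∪ ⁅ y ⁆) ++ᵥ K) × Path E ((⁅ x ⁆ ∪ ⁅ y ⁆) ++ᵥ K) (x ↑ˡ r) (y ↑ˡ r)
  pair-with-path {x} {y} o pendant-x pendant-y =
    let K , dense = overload-dense o in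
    K , dense ,
    dense⇒path dense (↑ˡ-∈⁺ {q = K} (x∈p∪q⁺ (inj₂ (x∈⁅x⁆ y)))) (separations-loose pendant-x pendant-y)

for-all-l<4 : ∀ {P : ℕ → Set} (P? : ∀ l → Dec (P l)) → {True (allUpTo? P? 4)} → ∀ {l} → l < 4 → P l
for-all-l<4 P? {checked} = toWitness checked

partner : Fin 4 → Fin 4
partner zero                   = # 1
partner (suc zero)             = # 0
partner (suc (suc zero))       = # 3
partner (suc (suc (suc zero))) = # 2

pendant-edges : ℕ → Fin 4 → List (Fin 5 × Fin 5)
pendant-edges l v =
  (# 1 , # 3) ∷ (# 2 , # 3) ∷ (# 1 , # 4) ∷ (suc (partner v) , # 0) ∷ replicate (4 ∸ l) (suc v , # 0)

pendant : ∀ {l} → l < 4 → (v : Fin 4) → PendantGraph l v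
pendant {l} l<4 v = record
  { edges = pendant-edges l v
  ; tight = for-all-l<4 (λ l → all? (λ v → tight? 2 l 5 (crossing₅ (pendant-edges l v)))) l<4 v
  ; heavy = for-all-l<4 (λ l → all? (λ v → 4 ≤? eCount (inside ∷ ⁅ v ⁆) (pendant-edges l v) + l)) l<4 v
  }

relabel : Fin 2 → Fin 4 → Fin 4
relabel zero       v                      = v
relabel (suc zero) zero                   = # 2
relabel (suc zero) (suc zero)             = # 3
relabel (suc zero) (suc (suc zero))       = # 0
relabel (suc zero) (suc (suc (suc zero))) = # 1

terminal-pair : Fin 2 → Subset 4
terminal-pair s = ⁅ relabel s (# 0) ⁆ ∪ ⁅ relabel s (# 1) ⁆

overloaded covering₁ covering₂ : Fin 2 → ℕ → List (Fin 4 × Fin 4)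
overloaded s l =
  mapEdges (relabel s) (replicate (4 ∸ l) (# 0 , # 1) ++ (# 0 , # 2) ∷ (# 1 , # 3) ∷ [])
covering₁ s l =
  mapEdges (relabel s) (replicate (3 ∸ l) (# 0 , # 1) ++ (# 0 , # 2) ∷ (# 1 , # 2) ∷ (# 0 , # 3) ∷ [])
covering₂ s l =
  mapEdges (relabel s) (replicate (3 ∸ l) (# 0 , # 1) ++ (# 0 , # 3) ∷ (# 1 , # 3) ∷ (# 0 , # 2) ∷ [])

overload : ∀ {l} → l < 4 → (s : Fin 2) → Overload l (terminal-pair s)
overload {l} l<4 s = record
  { edges        = overloaded s l
  ; cover₁       = covering₁ s l
  ; cover₂       = covering₂ s l
  ; not-tight    = for-all-l<4 (λ l → all? (λ s → ¬? (tight? 2 l 4 (crossing₄ (overloaded s l))))) l<4 s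
  ; cover₁-tight = for-all-l<4 (λ l → all? (λ s → tight? 2 l 4 (crossing₄ (covering₁ s l)))) l<4 s
  ; cover₂-tight = for-all-l<4 (λ l → all? (λ s → tight? 2 l 4 (crossing₄ (covering₂ s l)))) l<4 s
  ; same-length  = for-all-l<4 (λ l → all? (λ s →
                     length (overloaded s l) ≟ length (covering₁ s l))) l<4 s
  ; covered      = for-all-l<4 (λ l → all? (λ s → allSubset? (λ t →
                     ≡-decᵥ Bool._≟_ t (terminal-pair s) ⊎-dec
                     eCount t (overloaded s l) ≤? eCount t (covering₁ s l) ⊎-dec
                     eCount t (overloaded s l) ≤? eCount t (covering₂ s l)))) l<4 s
  ; light-at-T₀  = for-all-l<4 (λ l → all? (λ s →
                     eCount (terminal-pair s) (overloaded s l) + l ≤? 4)) l<4 s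
  }

lemma6 : (l : ℕ) → l ≤ 3 → (Γ : Gadget) → IsPlanarizingGadget l Γ →
    Σ (Subset (4 + Gadget.r Γ)) (λ S₁ →
      gA ∈ S₁ × gB ∈ S₁ × gC ∉ S₁ × gD ∉ S₁ ×
      2 * ∣ S₁ ∣ ≤ eCount S₁ (Gadget.edges Γ) + 3 × Path (Gadget.edges Γ) S₁ gA gB)
    × Σ (Subset (4 + Gadget.r Γ)) (λ S₂ →
      gC ∈ S₂ × gD ∈ S₂ × gA ∉ S₂ × gB ∉ S₂ ×
      2 * ∣ S₂ ∣ ≤ eCount S₂ (Gadget.edges Γ) + 3 × Path (Gadget.edges Γ) S₂ gC gD)
lemma6 l l≤3 Γ planar =
  let K₁ , dense₁ , path₁ = pair-with-path (overload l<4 (# 0)) (pendant l<4 (# 0)) (pendant l<4 (# 1))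
      K₂ , dense₂ , path₂ = pair-with-path (overload l<4 (# 1)) (pendant l<4 (# 2)) (pendant l<4 (# 3))
  in (_ , here , there here , (λ { (there (there ())) }) , (λ { (there (there (there ()))) }) ,
      dense₁ , path₁) ,
     (_ , there (there here) , there (there (there here)) , (λ ()) , (λ { (there ()) }) ,
      dense₂ , path₂)
  where
  open Planarizing planar
  l<4 : l < 4
  l<4 = s≤s l≤3
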